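{- For every $n\ge 2$, the configuration $\mathit{DCD}(n)$ is combinatorially self-polar, i.e.\ its Levi graph admits an automorphism of order two that interchanges the two classes of the bipartition.
   Context: $\mathit{DCD}(n)$ is the combinatorial configuration whose points are the $n$-element subsets and whose lines are the $(n-1)$-element subsets of a $(2n-1)$-element set, with a point incident with a line iff the line's subset is contained in the point's subset (equivalently, the point-line configuration of points where $n$ and lines where $n-1$ of $2n-1$ hyperplanes in general position in projective $n$-space meet). The Levi graph of a configuration is the bipartite graph whose two classes are the points and the lines, a point and a line being adjacent iff incident. -}

module Defs where

open import Data.Nat using (ℕ; _∸_; _*_; pred)
open import Data.Fin using (Fin)
open import Data.Fin.Subset using (Subset; ∣_∣; _⊆_)
open import Data.Product using (Σ; _×_; proj₁)
open import Data.Sum using (_⊎_; inj₁; inj₂)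
open import Data.Empty using (⊥)
open import Data.Unit using (⊤)
open import Relation.Binary.PropositionalEquality using (_≡_)

Ground : ℕ → ℕ
Ground n = 2 * n ∸ 1

DCDPoint : ℕ → Set
DCDPoint n = Σ (Subset (Ground n)) (λ s → ∣ s ∣ ≡ n)

DCDLine : ℕ → Set
DCDLine n = Σ (Subset (Ground n)) (λ s → ∣ s ∣ ≡ n ∸ 1)

Incident : (n : ℕ) → DCDPoint n → DCDLine n → Set
Incident n p l = proj₁ l ⊆ proj₁ p

LeviVertex : ℕ → Set
LeviVertex n = DCDPoint n ⊎ DCDLine n

LeviAdj : (n : ℕ) → LeviVertex n → LeviVertex n → Set
LeviAdj n (inj₁ p) (inj₁ q) = ⊥
LeviAdj n (inj₁ p) (inj₂ l) = Incident n p l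
LeviAdj n (inj₂ l) (inj₁ p) = Incident n p l
LeviAdj n (inj₂ l) (inj₂ m) = ⊥

IsPointVertex : (n : ℕ) → LeviVertex n → Set
IsPointVertex n (inj₁ _) = ⊤
IsPointVertex n (inj₂ _) = ⊥

-- vertices are equal iff same class and same underlying subset
-- (cardinality proofs are irrelevant)
SameVertex : (n : ℕ) → LeviVertex n → LeviVertex n → Set
SameVertex n (inj₁ p) (inj₁ q) = proj₁ p ≡ proj₁ q
SameVertex n (inj₁ p) (inj₂ l) = ⊥
SameVertex n (inj₂ l) (inj₁ p) = ⊥
SameVertex n (inj₂ l) (inj₂ m) = proj₁ l ≡ proj₁ m

-- An automorphism of order two of the Levi graph interchanging the
-- two classes: an involution σ (σ ∘ σ = id, hence a bijection, and
-- σ ≠ id since it swaps the nonempty classes) that preserves and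
-- reflects adjacency and maps points to lines and lines to points.
IsClassSwappingInvolutiveAutomorphism :
  (n : ℕ) → (LeviVertex n → LeviVertex n) → Set
IsClassSwappingInvolutiveAutomorphism n σ =
  ((v : LeviVertex n) → SameVertex n (σ (σ v)) v)
  × ((u v : LeviVertex n) → (LeviAdj n u v → LeviAdj n (σ u) (σ v))
                          × (LeviAdj n (σ u) (σ v) → LeviAdj n u v))
  × ((v : LeviVertex n) → (IsPointVertex n v → IsPointVertex n (σ v) → ⊥)
                        × ((IsPointVertex n v → ⊥) → IsPointVertex n (σ v)))

CombinatoriallySelfPolar : ℕ → Set
CombinatoriallySelfPolar n =
  Σ (LeviVertex n → LeviVertex n) (IsClassSwappingInvolutiveAutomorphism n)

-- Complementation in the (2n−1)-element ground set exchanges n-subsets and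
-- (n−1)-subsets, reverses inclusion and is an involution; hence it is a
-- polarity of DCD(n), i.e. an involutive automorphism of the Levi graph
-- swapping the two classes.
module Submission where

open import Defs
open import Data.Bool.Properties using (not-involutive)
open import Data.Nat using (ℕ; _≤_; zero; suc; _∸_; _+_)
open import Data.Nat.Properties using (+-identityʳ; +-suc; +-comm; m+n∸m≡n)
open import Data.Fin.Subset using (Subset; ∁; ∣_∣)
open import Data.Fin.Subset.Properties using (∣∁p∣≡n∸∣p∣; p⊆q⇒∁p⊇∁q; ∁p⊆∁q⇒p⊇q)
open import Data.Vec.Properties using (map-∘; map-cong; map-id)
open import Data.Product using (_,_; _×_)
open import Data.Empty using (⊥)
open import Data.Sum using (inj₁; inj₂)
open import Data.Unit using (tt)
open import Relation.Binary.PropositionalEquality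
  using (_≡_; refl; sym; trans; cong; cong₂; module ≡-Reasoning)

∁-involutive : ∀ {m} (p : Subset m) → ∁ (∁ p) ≡ p
∁-involutive p = trans (sym (map-∘ _ _ p)) (trans (map-cong not-involutive p) (map-id p))

∣∁p∣≡complementary : ∀ {m a b} (p : Subset m) → m ≡ a + b → ∣ p ∣ ≡ a → ∣ ∁ p ∣ ≡ b
∣∁p∣≡complementary {m} {a} {b} p m≡a+b ∣p∣≡a = begin
  ∣ ∁ p ∣      ≡⟨ ∣∁p∣≡n∸∣p∣ p ⟩
  m ∸ ∣ p ∣    ≡⟨ cong₂ _∸_ m≡a+b ∣p∣≡a ⟩
  a + b ∸ a    ≡⟨ m+n∸m≡n a b ⟩
  b            ∎
  where open ≡-Reasoning

Ground≡n+pred : ∀ n → Ground n ≡ n + (n ∸ 1)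
Ground≡n+pred zero    = refl
Ground≡n+pred (suc k) = trans (cong (λ x → k + suc x) (+-identityʳ k)) (+-suc k k)

Ground≡pred+n : ∀ n → Ground n ≡ (n ∸ 1) + n
Ground≡pred+n n = trans (Ground≡n+pred n) (+-comm n (n ∸ 1))

complementVertex : ∀ n → LeviVertex n → LeviVertex n
complementVertex n (inj₁ (s , ∣s∣≡n)) =
  inj₂ (∁ s , ∣∁p∣≡complementary s (Ground≡n+pred n) ∣s∣≡n)
complementVertex n (inj₂ (s , ∣s∣≡n-1)) =
  inj₁ (∁ s , ∣∁p∣≡complementary s (Ground≡pred+n n) ∣s∣≡n-1)

complementVertex-involutive : ∀ n (v : LeviVertex n) →
  SameVertex n (complementVertex n (complementVertex n v)) v
complementVertex-involutive n (inj₁ (s , _)) = ∁-involutive s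
complementVertex-involutive n (inj₂ (s , _)) = ∁-involutive s

complementVertex-preserves-adj : ∀ n (u v : LeviVertex n) →
  LeviAdj n u v → LeviAdj n (complementVertex n u) (complementVertex n v)
complementVertex-preserves-adj n (inj₁ _) (inj₂ _) = p⊆q⇒∁p⊇∁q
complementVertex-preserves-adj n (inj₂ _) (inj₁ _) = p⊆q⇒∁p⊇∁q

complementVertex-reflects-adj : ∀ n (u v : LeviVertex n) →
  LeviAdj n (complementVertex n u) (complementVertex n v) → LeviAdj n u v
complementVertex-reflects-adj n (inj₁ _) (inj₂ _) = ∁p⊆∁q⇒p⊇q
complementVertex-reflects-adj n (inj₂ _) (inj₁ _) = ∁p⊆∁q⇒p⊇q

DCD-combinatoriallySelfPolar : ∀ n → CombinatoriallySelfPolar n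
DCD-combinatoriallySelfPolar n =
  σ , complementVertex-involutive n , adjacency , swapsClasses
  where
  σ : LeviVertex n → LeviVertex n
  σ = complementVertex n

  adjacency : ∀ u v → (LeviAdj n u v → LeviAdj n (σ u) (σ v))
                    × (LeviAdj n (σ u) (σ v) → LeviAdj n u v)
  adjacency u v = complementVertex-preserves-adj n u v
                , complementVertex-reflects-adj n u v

  swapsClasses : ∀ v → (IsPointVertex n v → IsPointVertex n (σ v) → ⊥)
                     × ((IsPointVertex n v → ⊥) → IsPointVertex n (σ v))
  swapsClasses (inj₁ _) = (λ _ ()) , (λ point⇒⊥ → point⇒⊥ tt)
  swapsClasses (inj₂ _) = (λ ()) , (λ _ → tt)

-- The bound n ≥ 2 only matters for the geometric realisation of DCD(n).
corollary4p4 : (n : ℕ) → 2 ≤ n → CombinatoriallySelfPolar n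
corollary4p4 n _ = DCD-combinatoriallySelfPolar n
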